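{- Let $x=d_1\otimes\cdots\otimes d_n\in\dot F(s)$ be Yamanouchi and such that $d_i=\{1,\dots,\ell\}$ for some $i\in\{1,\dots,n\}$. Then $D(x)=D(x^\times)$, where $x^\times$ is obtained from $x$ by deleting its leftmost factor equal to $\{1,\dots,\ell\}$.
   Context: Fix integers $\ell\ge2$, $n\ge1$, $s\ge0$. $\dot F(s)$ (for given $n$): set of $d_1\otimes\cdots\otimes d_n$ of columns $d_i\subseteq\{1,\dots,\ell\}$ with $\sum|d_i|=s$. Word: entries of $d_1$ (increasing), then $d_2$, ..., $d_n$; Yamanouchi: every prefix has at least as many letters $k$ as $k+1$. Type $A_{\ell-1}$ crystal: for letters $j,j+1$ encode $j$ as $+$, $j+1$ as $-$, delete adjacent $+-$ recursively; $\dot f_j$ changes the $j$ of the leftmost remaining $+$ into $j+1$, $\dot e_j$ the $j+1$ of the rightmost remaining $-$ into $j$ (or $0$). $B(\omega_k)$: crystal of columns of size $k$. $R_i$: replaces the factor $d_i\otimes d_{i+1}$ by its image under the unique $A_{\ell-1}$-crystal isomorphism $B(\omega_{|d_i|})\otimes B(\omega_{|d_{i+1}|})\to B(\omega_{|d_{i+1}|})\otimes B(\omega_{|d_i|})$. Local energy of two columns $d_1\otimes d_2$: if $|d_1|\ge|d_2|$, place $d_1$ as a right column in rows $1,\dots,|d_1|$ and $d_2$ as a left column in rows $t+1,\dots,t+|d_2|$ with $t\ge0$ minimal such that $t+|d_2|\ge|d_1|$ and in every row containing two cells the left entry is $\le$ the right entry; then $H(d_1\otimes d_2)$ is the number of cells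 of the left column with no cell to their right, i.e. $t+|d_2|-|d_1|$. If $|d_1|<|d_2|$, $H(d_1\otimes d_2)=H(R_1(d_1\otimes d_2))$. Energy: for $x=d_1\otimes\cdots\otimes d_n$ and $1\le i<j\le n$, let $d_{i+1}^{(j)}$ be the $(i+1)$-th factor of the element obtained from $x$ by applying successively $R_{j-1},R_{j-2},\dots,R_{i+1}$ (no map if $j=i+1$); then $D(x)=\sum_{1\le i<j\le n}H(d_i\otimes d_{i+1}^{(j)})$. -}

module Defs where

open import Data.Nat using (ℕ; zero; suc; _+_; _*_; _∸_; _≤_; _≡ᵇ_; _≤ᵇ_)
open import Data.Bool using (Bool; true; false; _∧_; if_then_else_)
open import Data.List using (List; []; _∷_; _++_; length; map; concat; concatMap; take; drop; reverse; upTo; zipWith; foldl)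
open import Data.Nat.ListAction using (sum)
open import Data.Bool.ListAction using (and)
open import Data.List.Relation.Unary.All using (All)
open import Data.List.Relation.Unary.Linked using (Linked)
open import Data.Maybe using (Maybe; just; nothing)
open import Data.Product using (_×_; _,_)
open import Relation.Binary.PropositionalEquality using (_≡_)
open import Data.Nat using (_<_)

-- Basic list utilities.  Letters are natural numbers 1..ℓ; a column is
-- the list of its entries in increasing order; an element
-- d₁ ⊗ ⋯ ⊗ dₙ is the list [d₁ , … , dₙ].

Column : Set
Column = List ℕ

-- range lo hi = [lo, lo+1, …, hi]  (empty if hi < lo)
range : ℕ → ℕ → List ℕ
range lo hi = map (lo +_) (upTo (suc hi ∸ lo))

count : ℕ → List ℕ → ℕ
count k [] = 0
count k (c ∷ w) = if k ≡ᵇ c then suc (count k w) else count k w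

listEq : List ℕ → List ℕ → Bool
listEq [] [] = true
listEq (a ∷ as) (b ∷ bs) = (a ≡ᵇ b) ∧ listEq as bs
listEq _ _ = false

allB : {A : Set} → (A → Bool) → List A → Bool
allB p [] = true
allB p (a ∷ as) = p a ∧ allB p as

filterB : {A : Set} → (A → Bool) → List A → List A
filterB p [] = []
filterB p (a ∷ as) = if p a then a ∷ filterB p as else filterB p as

findFirst : {A : Set} → (A → Bool) → List A → Maybe A
findFirst p [] = nothing
findFirst p (a ∷ as) = if p a then just a else findFirst p as

lastM : List ℕ → Maybe ℕ
lastM [] = nothing
lastM (a ∷ []) = just a
lastM (a ∷ b ∷ as) = lastM (b ∷ as)

headM : List ℕ → Maybe ℕ
headM [] = nothing
headM (a ∷ _) = just a

setAt : ℕ → ℕ → List ℕ → List ℕ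
setAt p v [] = []
setAt zero v (_ ∷ w) = v ∷ w
setAt (suc p) v (c ∷ w) = c ∷ setAt p v w

-- 1-indexed lookup of a factor, default the empty column
nth : ℕ → List Column → Column
nth k x = go (k ∸ 1) x
  where
  go : ℕ → List Column → Column
  go _ [] = []
  go zero (d ∷ _) = d
  go (suc m) (_ ∷ r) = go m r

IsColumn : ℕ → Column → Set
IsColumn ℓ d = Linked _<_ d × All (λ k → (1 ≤ k) × (k ≤ ℓ)) d

InFdot : ℕ → ℕ → ℕ → List Column → Set
InFdot ℓ n s x = (length x ≡ n) × All (IsColumn ℓ) x × (sum (map length x) ≡ s)

word : List Column → List ℕ
word = concat

Yamanouchi : List ℕ → Set
Yamanouchi w = ∀ (m k : ℕ) → 1 ≤ k → count (suc k) (take m w) ≤ count k (take m w)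

fullColumn : ℕ → Column
fullColumn ℓ = range 1 ℓ

deleteFull : ℕ → List Column → List Column
deleteFull ℓ [] = []
deleteFull ℓ (d ∷ x) = if listEq d (fullColumn ℓ) then x else d ∷ deleteFull ℓ x

-- scan j p w ps ms : ps = positions of unmatched '+' (most recent first),
-- ms = positions of unmatched '-' (most recent first).
scan : ℕ → ℕ → List ℕ → List ℕ → List ℕ → List ℕ × List ℕ
scan j p [] ps ms = ps , ms
scan j p (c ∷ w) ps ms =
  if c ≡ᵇ j then scan j (suc p) w (p ∷ ps) ms
  else (if c ≡ᵇ suc j then minus ps else scan j (suc p) w ps ms)
  where
  minus : List ℕ → List ℕ × List ℕ
  minus [] = scan j (suc p) w [] (p ∷ ms)
  minus (_ ∷ ps') = scan j (suc p) w ps' ms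

plusesOf : ℕ → List ℕ → List ℕ
plusesOf j w with scan j 0 w [] []
... | ps , _ = ps

minusesOf : ℕ → List ℕ → List ℕ
minusesOf j w with scan j 0 w [] []
... | _ , ms = ms

-- ḟ_j : leftmost unmatched j becomes j+1
fOp : ℕ → List ℕ → Maybe (List ℕ)
fOp j w with lastM (plusesOf j w)
... | nothing = nothing
... | just p = just (setAt p (suc j) w)

-- ė_j : rightmost unmatched j+1 becomes j
eOp : ℕ → List ℕ → Maybe (List ℕ)
eOp j w with headM (minusesOf j w)
... | nothing = nothing
... | just p = just (setAt p j w)

isNothing : {A : Set} → Maybe A → Bool
isNothing nothing = true
isNothing (just _) = false

isHW : ℕ → List ℕ → Bool
isHW ℓ w = allB (λ j → isNothing (eOp j w)) (range 1 (ℓ ∸ 1))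

weight : ℕ → List ℕ → List ℕ
weight ℓ w = map (λ k → count k w) (range 1 ℓ)

firstE : List ℕ → List ℕ → Maybe (ℕ × List ℕ)
firstE [] w = nothing
firstE (j ∷ js) w with eOp j w
... | just w' = just (j , w')
... | nothing = firstE js w

-- go up to the highest weight element, recording the e_j's used
-- (most recent first).  Fuel bound: each step decreases the letter sum.
hwPath : ℕ → ℕ → List ℕ → List ℕ → List ℕ × List ℕ
hwPath zero ℓ w acc = w , acc
hwPath (suc k) ℓ w acc with firstE (range 1 (ℓ ∸ 1)) w
... | nothing = w , acc
... | just (j , w') = hwPath k ℓ w' (j ∷ acc)

applyFs : List ℕ → List ℕ → Maybe (List ℕ)
applyFs [] w = just w
applyFs (j ∷ js) w with fOp j w
... | nothing = nothing
... | just w' = applyFs js w'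

-- Combinatorial R-matrix B(ω_a) ⊗ B(ω_b) → B(ω_b) ⊗ B(ω_a):
-- the unique crystal isomorphism, computed by moving to the highest
-- weight element, sending it to the (unique) highest weight element of
-- the same weight in the target, and moving back down.

subs : List ℕ → List (List ℕ)
subs [] = [] ∷ []
subs (a ∷ as) = map (a ∷_) (subs as) ++ subs as

columnsOfSize : ℕ → ℕ → List Column
columnsOfSize ℓ b = filterB (λ c → length c ≡ᵇ b) (subs (range 1 ℓ))

-- words of c₁ ⊗ c₂ with |c₁| = b, |c₂| = a
candidates : ℕ → ℕ → ℕ → List (List ℕ)
candidates ℓ a b = concatMap (λ c₁ → map (c₁ ++_) (columnsOfSize ℓ a)) (columnsOfSize ℓ b)

Rpair : ℕ → Column → Column → Column × Column
Rpair ℓ d₁ d₂ with hwPath (length (d₁ ++ d₂) * ℓ) ℓ (d₁ ++ d₂) []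
... | h , path with findFirst (λ c → isHW ℓ c ∧ listEq (weight ℓ c) (weight ℓ h))
                              (candidates ℓ (length d₁) (length d₂))
...   | nothing = d₁ , d₂
...   | just c with applyFs path c
...     | nothing = d₁ , d₂
...     | just y = take (length d₂) y , drop (length d₂) y

-- R_m (1-indexed) acting on factors m, m+1
swapAt : ℕ → ℕ → List Column → List Column
swapAt ℓ zero (d₁ ∷ d₂ ∷ r) with Rpair ℓ d₁ d₂
... | e₁ , e₂ = e₁ ∷ e₂ ∷ r
swapAt ℓ zero x = x
swapAt ℓ (suc k) [] = []
swapAt ℓ (suc k) (d ∷ r) = d ∷ swapAt ℓ k r

applyR : ℕ → ℕ → List Column → List Column
applyR ℓ m x = swapAt ℓ (m ∸ 1) x

okRows : Column → Column → Bool
okRows l r = and (zipWith _≤ᵇ_ l r)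

findT : ℕ → ℕ → Column → Column → ℕ
findT zero t d₁ d₂ = t
findT (suc k) t d₁ d₂ = if okRows d₂ (drop t d₁) then t else findT k (suc t) d₁ d₂

-- case |d₁| ≥ |d₂| : t ranges over |d₁|-|d₂|, …, |d₁|
Hgeq : Column → Column → ℕ
Hgeq d₁ d₂ = findT (suc (length d₁)) (length d₁ ∸ length d₂) d₁ d₂ + length d₂ ∸ length d₁

H : ℕ → Column → Column → ℕ
H ℓ d₁ d₂ with length d₂ ≤ᵇ length d₁
... | true = Hgeq d₁ d₂
... | false with Rpair ℓ d₁ d₂
...   | e₁ , e₂ = Hgeq e₁ e₂

-- apply R_{j-1}, R_{j-2}, …, R_{i+1} in this order
chain : ℕ → ℕ → ℕ → List Column → List Column
chain ℓ i j x = foldl (λ y m → applyR ℓ m y) x (reverse (range (suc i) (j ∸ 1)))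

D : ℕ → List Column → ℕ
D ℓ x = sum (concatMap (λ i → map (λ j → H ℓ (nth i x) (nth (suc i) (chain ℓ i j x)))
                                   (range (suc i) n))
                       (range 1 n))
  where
  n = length x

{-# OPTIONS --safe #-}
module Submission where

-- The full column {1,…,ℓ} is invisible to the signature rule: for every j its letters j and j + 1
-- are adjacent and cancel.  Hence the crystal operators commute with adding the full column on
-- either side.  So if h is the highest weight column of d, then h ⊗ full is the highest weight
-- element of d ⊗ full, full ⊗ h is the only highest weight element of that weight on the other
-- side, and the same lowering path carries it to full ⊗ d: the combinatorial R-matrix moves the
-- full column across any column, in either direction.  A column of height ℓ leaves no cell of its
-- neighbour unpaired, so the local energy of the full column with any column is 0.  Finally
-- D(d ⊗ y) = Σⱼ H(d ⊗ d′ⱼ) + D(y), where d′ⱼ is the j-th factor of y carried to the front by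
-- R-matrices: the full column contributes nothing, neither as d nor as some d′ⱼ, and carrying
-- factors across it changes none of the others.

open import Defs
open import Data.Bool using (Bool; true; false; _∧_)
open import Data.Bool.Properties using (T-≡)
open import Data.List using (List; []; _∷_; _++_; length; map; concat; concatMap; take; drop; foldr; applyUpTo)
import Data.List.Properties as List
open import Data.List.Membership.Propositional using (_∈_; find; lose)
open import Data.List.Membership.Propositional.Properties
  using (∈-map⁺; ∈-map⁻; ∈-++⁺ˡ; ∈-++⁺ʳ; ∈-++⁻; ∈-concatMap⁺; ∈-concatMap⁻)
open import Data.List.Relation.Unary.All as All using (All; []; _∷_)
import Data.List.Relation.Unary.All.Properties as All
open import Data.List.Relation.Unary.Any using (here; there)
open import Data.List.Relation.Unary.Linked as Linked using (Linked; []; [-]; _∷_)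
open import Data.List.Relation.Unary.Linked.Properties using (Linked⇒All)
open import Data.Maybe as Maybe using (Maybe; just; nothing)
import Data.Maybe.Properties as Maybe
import Data.Maybe.Relation.Unary.All as MaybeAll
open import Data.Nat using (ℕ; zero; suc; _+_; _*_; _∸_; _≤_; _<_; _≡ᵇ_; _≤ᵇ_; z≤n; s≤s; z<s)
open import Data.Nat.ListAction using (sum)
open import Data.Nat.ListAction.Properties using (sum-++)
open import Data.Nat.Properties
open import Data.Product as Product using (_×_; _,_; proj₁; proj₂; ∃; uncurry)
open import Data.Sum as Sum using (_⊎_; inj₁; inj₂)
open import Function using (_∘_; Equivalence)
open import Relation.Binary using (tri<; tri≈; tri>)
open import Relation.Binary.PropositionalEquality
open import Relation.Nullary using (yes; no; contradiction)
open import Relation.Nullary.Decidable using (dec-true; dec-false)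

≡ᵇ-refl : ∀ n → (n ≡ᵇ n) ≡ true
≡ᵇ-refl n = dec-true (n ≟ n) refl

≢⇒≡ᵇ≡false : ∀ {m n} → m ≢ n → (m ≡ᵇ n) ≡ false
≢⇒≡ᵇ≡false {m} {n} = dec-false (m ≟ n)

≡ᵇ≡true⇒≡ : ∀ {m n} → (m ≡ᵇ n) ≡ true → m ≡ n
≡ᵇ≡true⇒≡ {m} {n} = ≡ᵇ⇒≡ m n ∘ Equivalence.from T-≡

≤⇒≤ᵇ≡true : ∀ {m n} → m ≤ n → (m ≤ᵇ n) ≡ true
≤⇒≤ᵇ≡true = Equivalence.to T-≡ ∘ ≤⇒≤ᵇ

1+n≡ᵇn≡false : ∀ n → (suc n ≡ᵇ n) ≡ false
1+n≡ᵇn≡false n = ≢⇒≡ᵇ≡false (1+n≢n {n})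

-- Intervals, increasing words and letter counts

Increasing : List ℕ → Set
Increasing = Linked _<_

iota : ℕ → ℕ → List ℕ
iota a zero = []
iota a (suc k) = a ∷ iota (suc a) k

applyUpTo≡iota : ∀ a k (f : ℕ → ℕ) → (∀ i → f i ≡ a + i) → applyUpTo f k ≡ iota a k
applyUpTo≡iota a zero f f≗a+ = refl
applyUpTo≡iota a (suc k) f f≗a+ = cong₂ _∷_ (trans (f≗a+ 0) (+-identityʳ a))
  (applyUpTo≡iota (suc a) k (λ i → f (suc i)) (λ i → trans (f≗a+ (suc i)) (+-suc a i)))

range≡iota : ∀ a b → range a b ≡ iota a (suc b ∸ a)
range≡iota a b = trans (List.map-applyUpTo (λ i → i) (a +_) (suc b ∸ a))
                       (applyUpTo≡iota a (suc b ∸ a) (a +_) (λ _ → refl))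

length-iota : ∀ a k → length (iota a k) ≡ k
length-iota a zero = refl
length-iota a (suc k) = cong suc (length-iota (suc a) k)

map-suc-iota : ∀ a k → map suc (iota a k) ≡ iota (suc a) k
map-suc-iota a zero = refl
map-suc-iota a (suc k) = cong (suc a ∷_) (map-suc-iota (suc a) k)

drop-iota : ∀ t a k → drop t (iota a k) ≡ iota (a + t) (k ∸ t)
drop-iota zero a k rewrite +-identityʳ a = refl
drop-iota (suc t) a zero = refl
drop-iota (suc t) a (suc k) rewrite +-suc a t = drop-iota t (suc a) k

∈-iota⁻ : ∀ {x} a k → x ∈ iota a k → a ≤ x × x < a + k
∈-iota⁻ a (suc k) (here refl) = ≤-refl , m<m+n a z<s
∈-iota⁻ {x} a (suc k) (there x∈) with ∈-iota⁻ (suc a) k x∈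
... | a<x , x<1+a+k = <⇒≤ a<x , subst (x <_) (sym (+-suc a k)) x<1+a+k

∈-iota⁺ : ∀ {x} a k → a ≤ x → x < a + k → x ∈ iota a k
∈-iota⁺ {x} a zero a≤x x<a+0 = contradiction (subst (x <_) (+-identityʳ a) x<a+0) (≤⇒≯ a≤x)
∈-iota⁺ {x} a (suc k) a≤x x<a+1+k with m≤n⇒m<n∨m≡n a≤x
... | inj₂ refl = here refl
... | inj₁ a<x = there (∈-iota⁺ (suc a) k a<x (subst (x <_) (+-suc a k) x<a+1+k))

∈-iota-tail : ∀ {y} a k → y ∈ iota a (suc k) → a < y → y ∈ iota (suc a) k
∈-iota-tail a k (here refl) a<a = contradiction a<a (<-irrefl refl)
∈-iota-tail a k (there y∈) _ = y∈

iota-positive : ∀ a k → All (1 ≤_) (iota (suc a) k)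
iota-positive a k = All.tabulate λ m∈ → ≤-trans (s≤s z≤n) (proj₁ (∈-iota⁻ (suc a) k m∈))

iota-increasing : ∀ a k → Increasing (iota a k)
iota-increasing a zero = []
iota-increasing a (suc zero) = [-]
iota-increasing a (suc (suc k)) = n<1+n a ∷ iota-increasing (suc a) (suc k)

increasing⇒head< : ∀ {x c} → Increasing (x ∷ c) → All (x <_) c
increasing⇒head< [-] = []
increasing⇒head< (x<y ∷ l) = Linked⇒All <-trans x<y l

head<⇒increasing : ∀ {x c} → All (x <_) c → Increasing c → Increasing (x ∷ c)
head<⇒increasing [] _ = [-]
head<⇒increasing (x<y ∷ _) l = x<y ∷ l

increasing-++⁻ : ∀ c {d} → Increasing (c ++ d) → Increasing c × Increasing d
increasing-++⁻ [] l = [] , l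
increasing-++⁻ (x ∷ c) l with increasing-++⁻ c (Linked.tail l)
... | lc , ld = head<⇒increasing (All.++⁻ˡ c (increasing⇒head< l)) lc , ld

increasing-insert : ∀ lo {m hi} → Increasing lo → All (_< m) lo → Increasing (m ∷ hi) →
  Increasing (lo ++ m ∷ hi)
increasing-insert [] _ _ l = l
increasing-insert (x ∷ lo) l (x<m ∷ lo<m) lm = head<⇒increasing
  (All.++⁺ (increasing⇒head< l) (x<m ∷ All.map (<-trans x<m) (increasing⇒head< lm)))
  (increasing-insert lo (Linked.tail l) lo<m lm)

increasing-head+length< : ∀ {M} x c → Increasing (x ∷ c) → All (_< M) (x ∷ c) → x + length c < M
increasing-head+length< {M} x [] _ (x<M ∷ _) = subst (_< M) (sym (+-identityʳ x)) x<M
increasing-head+length< {M} x (y ∷ c) (x<y ∷ l) (_ ∷ c<M) = subst (_< M) (sym (+-suc x (length c)))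
  (<-≤-trans (s≤s (+-monoˡ-< (length c) x<y)) (increasing-head+length< y c l c<M))

∈-subs⁺ : ∀ a k {c} → Increasing c → All (_∈ iota a k) c → c ∈ subs (iota a k)
∈-subs⁺ a zero {[]} _ _ = here refl
∈-subs⁺ a zero {_ ∷ _} _ (() ∷ _)
∈-subs⁺ a (suc k) {[]} _ _ = ∈-++⁺ʳ (map (a ∷_) (subs (iota (suc a) k))) (∈-subs⁺ (suc a) k [] [])
∈-subs⁺ a (suc k) {x ∷ c} inc (here refl ∷ c∈) = ∈-++⁺ˡ (∈-map⁺ (a ∷_)
  (∈-subs⁺ (suc a) k (Linked.tail inc) (All.zipWith (uncurry (∈-iota-tail a k)) (c∈ , increasing⇒head< inc))))
∈-subs⁺ a (suc k) {x ∷ c} inc (there x∈ ∷ c∈) = ∈-++⁺ʳ (map (a ∷_) (subs (iota (suc a) k)))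
  (∈-subs⁺ (suc a) k inc (x∈ ∷ All.zipWith (λ (y∈ , x<y) → ∈-iota-tail a k y∈ (<-trans a<x x<y))
                                           (c∈ , increasing⇒head< inc)))
  where a<x = proj₁ (∈-iota⁻ (suc a) k x∈)

∈-subs⁻ : ∀ a k {c} → c ∈ subs (iota a k) → Increasing c × All (_∈ iota a k) c
∈-subs⁻ a zero (here refl) = [] , []
∈-subs⁻ a (suc k) c∈ with ∈-++⁻ (map (a ∷_) (subs (iota (suc a) k))) c∈
... | inj₁ ac∈ with ∈-map⁻ (a ∷_) ac∈
...   | c , c∈' , refl with ∈-subs⁻ (suc a) k c∈'
...     | inc , c⊆ = head<⇒increasing (All.map (proj₁ ∘ ∈-iota⁻ (suc a) k) c⊆) inc
                   , here refl ∷ All.map there c⊆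
∈-subs⁻ a (suc k) c∈ | inj₂ c∈' with ∈-subs⁻ (suc a) k c∈'
... | inc , c⊆ = inc , All.map there c⊆

increasing-⊆-iota : ∀ a k {c} → Increasing c → All (_∈ iota a k) c → length c ≡ k → c ≡ iota a k
increasing-⊆-iota a zero {[]} _ _ _ = refl
increasing-⊆-iota a (suc k) {x ∷ c} inc (here refl ∷ c∈) refl = cong (a ∷_)
  (increasing-⊆-iota (suc a) k (Linked.tail inc)
    (All.zipWith (uncurry (∈-iota-tail a k)) (c∈ , increasing⇒head< inc)) refl)
increasing-⊆-iota a (suc k) {x ∷ c} inc (there x∈ ∷ c∈) refl =
  contradiction (<-≤-trans (increasing-head+length< x c inc below) (+-monoˡ-≤ k a<x)) (<-irrefl refl)
  where
  a<x = proj₁ (∈-iota⁻ (suc a) k x∈)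
  below : All (_< suc a + k) (x ∷ c)
  below = proj₂ (∈-iota⁻ (suc a) k x∈)
        ∷ All.map (λ {y} y∈ → subst (y <_) (+-suc a k) (proj₂ (∈-iota⁻ a (suc k) y∈))) c∈

count-++ : ∀ k u w → count k (u ++ w) ≡ count k u + count k w
count-++ k [] w = refl
count-++ k (c ∷ u) w with k ≡ᵇ c
... | true = cong suc (count-++ k u w)
... | false = count-++ k u w

count-++-comm : ∀ k u w → count k (u ++ w) ≡ count k (w ++ u)
count-++-comm k u w = trans (count-++ k u w) (trans (+-comm (count k u) (count k w)) (sym (count-++ k w u)))

count-head : ∀ b c → 0 < count b (b ∷ c)
count-head b c rewrite ≡ᵇ-refl b = z<s

count>0⇒head≤ : ∀ k b c → Increasing (b ∷ c) → 0 < count k (b ∷ c) → b ≤ k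
count>0⇒head≤ k b c inc pos with k ≡ᵇ b in k≡ᵇb
... | true = ≤-reflexive (sym (≡ᵇ≡true⇒≡ k≡ᵇb))
count>0⇒head≤ k b (b' ∷ c) (b<b' ∷ inc) pos | false = ≤-trans (<⇒≤ b<b') (count>0⇒head≤ k b' c inc pos)

increasing-count-injective : ∀ {L c d} → Increasing c → Increasing d → All (_∈ L) c → All (_∈ L) d →
  (∀ {k} → k ∈ L → count k c ≡ count k d) → c ≡ d
increasing-count-injective {c = []} {[]} _ _ _ _ _ = refl
increasing-count-injective {c = []} {b ∷ d} _ _ _ (b∈ ∷ _) same =
  contradiction (sym (same b∈)) (>⇒≢ (count-head b d))
increasing-count-injective {c = a ∷ c} {[]} _ _ (a∈ ∷ _) _ same =
  contradiction (same a∈) (>⇒≢ (count-head a c))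
increasing-count-injective {c = a ∷ c} {b ∷ d} inc-c inc-d (a∈ ∷ c∈) (b∈ ∷ d∈) same
  with ≤-antisym (count>0⇒head≤ b a c inc-c (subst (0 <_) (sym (same b∈)) (count-head b d)))
                 (count>0⇒head≤ a b d inc-d (subst (0 <_) (same a∈) (count-head a c)))
... | refl = cong (a ∷_) (increasing-count-injective (Linked.tail inc-c) (Linked.tail inc-d) c∈ d∈ same-tail)
  where
  same-tail : ∀ {k} → _ → count k c ≡ count k d
  same-tail {k} k∈ = +-cancelˡ-≡ (count k (a ∷ [])) (count k c) (count k d)
    (trans (sym (count-++ k (a ∷ []) c)) (trans (same k∈) (count-++ k (a ∷ []) d)))

take-length-++ : ∀ (u w : List ℕ) → take (length u) (u ++ w) ≡ u
take-length-++ [] w = refl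
take-length-++ (x ∷ u) w = cong (x ∷_) (take-length-++ u w)

drop-length-++ : ∀ (u w : List ℕ) → drop (length u) (u ++ w) ≡ w
drop-length-++ [] w = refl
drop-length-++ (x ∷ u) w = drop-length-++ u w

map≡⇒pointwise : ∀ (f g : ℕ → ℕ) xs → map f xs ≡ map g xs → ∀ {x} → x ∈ xs → f x ≡ g x
map≡⇒pointwise f g (_ ∷ xs) eq (here refl) = List.∷-injectiveˡ eq
map≡⇒pointwise f g (_ ∷ xs) eq (there x∈) = map≡⇒pointwise f g xs (List.∷-injectiveʳ eq) x∈

∈-filterB⁻ : ∀ {A : Set} (p : A → Bool) xs {y} → y ∈ filterB p xs → y ∈ xs × p y ≡ true
∈-filterB⁻ p (x ∷ xs) y∈ with p x in px
∈-filterB⁻ p (x ∷ xs) (here refl) | true = here refl , px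
∈-filterB⁻ p (x ∷ xs) (there y∈) | true = Product.map₁ there (∈-filterB⁻ p xs y∈)
... | false = Product.map₁ there (∈-filterB⁻ p xs y∈)

∈-filterB⁺ : ∀ {A : Set} (p : A → Bool) xs {y} → y ∈ xs → p y ≡ true → y ∈ filterB p xs
∈-filterB⁺ p (x ∷ xs) (here refl) py rewrite py = here refl
∈-filterB⁺ p (x ∷ xs) (there y∈) py with p x
... | true = there (∈-filterB⁺ p xs y∈ py)
... | false = ∈-filterB⁺ p xs y∈ py

findFirst-∈ : ∀ {A : Set} (p : A → Bool) xs {y} → findFirst p xs ≡ just y → y ∈ xs
findFirst-∈ p (x ∷ xs) eq with p x
findFirst-∈ p (x ∷ xs) refl | true = here refl
... | false = there (findFirst-∈ p xs eq)

findFirst-unique : ∀ {A : Set} (p : A → Bool) xs {y} → y ∈ xs → p y ≡ true →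
  (∀ {z} → z ∈ xs → p z ≡ true → z ≡ y) → findFirst p xs ≡ just y
findFirst-unique p (x ∷ xs) y∈ py unique with p x in px
... | true = cong just (unique (here refl) px)
findFirst-unique p (x ∷ xs) (here refl) py unique | false = contradiction (trans (sym px) py) λ ()
findFirst-unique p (x ∷ xs) (there y∈) py unique | false = findFirst-unique p xs y∈ py (unique ∘ there)

∧≡true : ∀ {a b} → (a ∧ b) ≡ true → a ≡ true × b ≡ true
∧≡true {true} {true} _ = refl , refl

listEq-sound : ∀ as bs → listEq as bs ≡ true → as ≡ bs
listEq-sound [] [] _ = refl
listEq-sound (a ∷ as) (b ∷ bs) eq = let a≡b , as≡bs = ∧≡true {a ≡ᵇ b} eq in
  cong₂ _∷_ (≡ᵇ≡true⇒≡ a≡b) (listEq-sound as bs as≡bs)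

listEq-refl : ∀ as → listEq as as ≡ true
listEq-refl [] = refl
listEq-refl (a ∷ as) rewrite ≡ᵇ-refl a = listEq-refl as

sum-map-remove-zero : ∀ {A : Set} (f : A → ℕ) xs {z} ys → f z ≡ 0 →
  sum (map f (xs ++ z ∷ ys)) ≡ sum (map f (xs ++ ys))
sum-map-remove-zero f [] ys fz≡0 rewrite fz≡0 = refl
sum-map-remove-zero f (x ∷ xs) ys fz≡0 = cong (f x +_) (sum-map-remove-zero f xs ys fz≡0)

sum-map-zero : ∀ {A : Set} {f : A → ℕ} {xs} → All (λ x → f x ≡ 0) xs → sum (map f xs) ≡ 0
sum-map-zero [] = refl
sum-map-zero (fx≡0 ∷ rest) rewrite fx≡0 = sum-map-zero rest

map-++-∷-fixed : ∀ {A : Set} (f : A → A) xs {z} ys → f z ≡ z →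
  map f (xs ++ z ∷ ys) ≡ map f xs ++ z ∷ map f ys
map-++-∷-fixed f xs ys fz≡z = trans (List.map-++ f xs (_ ∷ ys)) (cong (λ e → map f xs ++ e ∷ map f ys) fz≡z)

-- The signature rule

Avoids : ℕ → ℕ → Set
Avoids j c = c ≢ j × c ≢ suc j

Transparent : ℕ → List ℕ → Set
Transparent j t = ∀ p ps ms → scan j p t ps ms ≡ (ps , ms)

scan-++ : ∀ j p u w ps ms → scan j p (u ++ w) ps ms ≡ uncurry (scan j (p + length u) w) (scan j p u ps ms)
scan-++ j p [] w ps ms rewrite +-identityʳ p = refl
scan-++ j p (c ∷ u) w ps ms rewrite +-suc p (length u) with c ≡ᵇ j
... | true = scan-++ j (suc p) u w (p ∷ ps) ms
... | false with c ≡ᵇ suc j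
...   | false = scan-++ j (suc p) u w ps ms
scan-++ j p (c ∷ u) w [] ms | false | true = scan-++ j (suc p) u w [] (p ∷ ms)
scan-++ j p (c ∷ u) w (_ ∷ ps) ms | false | true = scan-++ j (suc p) u w ps ms

transparent-++ : ∀ {j} t {u} → Transparent j t → Transparent j u → Transparent j (t ++ u)
transparent-++ {j} t {u} tr-t tr-u p ps ms rewrite scan-++ j p t u ps ms | tr-t p ps ms = tr-u _ ps ms

avoiding⇒transparent : ∀ {j t} → All (Avoids j) t → Transparent j t
avoiding⇒transparent [] p ps ms = refl
avoiding⇒transparent {j} {c ∷ t} ((c≢j , c≢1+j) ∷ avoid) p ps ms
  rewrite ≢⇒≡ᵇ≡false c≢j | ≢⇒≡ᵇ≡false c≢1+j = avoiding⇒transparent avoid (suc p) ps ms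

pair-transparent : ∀ j → Transparent j (j ∷ suc j ∷ [])
pair-transparent j p ps ms rewrite ≡ᵇ-refl j | 1+n≡ᵇn≡false j = refl

<⇒avoids : ∀ {j c} → c < j → Avoids j c
<⇒avoids c<j = <⇒≢ c<j , <⇒≢ (m<n⇒m<1+n c<j)

>⇒avoids : ∀ {j c} → suc j < c → Avoids j c
>⇒avoids 1+j<c = >⇒≢ (<-trans (n<1+n _) 1+j<c) , >⇒≢ 1+j<c

iota-transparent : ∀ {j} a k → a ≤ j → suc j < a + k → Transparent j (iota a k)
iota-transparent {j} a zero a≤j 1+j<a+0 =
  contradiction (subst (suc j <_) (+-identityʳ a) 1+j<a+0) (≤⇒≯ (m≤n⇒m≤1+n a≤j))
iota-transparent {j} a (suc k) a≤j 1+j<a+1+k with m≤n⇒m<n∨m≡n a≤j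
... | inj₁ a<j = transparent-++ (a ∷ []) (avoiding⇒transparent (<⇒avoids a<j ∷ []))
                   (iota-transparent (suc a) k a<j (subst (suc j <_) (+-suc a k) 1+j<a+1+k))
iota-transparent {j} a (suc zero) a≤j 1+j<a+1 | inj₂ refl = contradiction 1+j<a+1 (<-irrefl (+-comm 1 a))
iota-transparent {j} a (suc (suc k)) a≤j _ | inj₂ refl =
  transparent-++ (a ∷ suc a ∷ []) (pair-transparent a)
    (avoiding⇒transparent (All.tabulate (>⇒avoids ∘ proj₁ ∘ ∈-iota⁻ (suc (suc a)) k)))

scan-shift : ∀ j k p w ps ms →
  scan j (k + p) w (map (k +_) ps) (map (k +_) ms) ≡ Product.map (map (k +_)) (map (k +_)) (scan j p w ps ms)
scan-shift j k p [] ps ms = refl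
scan-shift j k p (c ∷ w) ps ms with c ≡ᵇ j
... | true rewrite sym (+-suc k p) = scan-shift j k (suc p) w (p ∷ ps) ms
... | false with c ≡ᵇ suc j
...   | false rewrite sym (+-suc k p) = scan-shift j k (suc p) w ps ms
scan-shift j k p (c ∷ w) [] ms | false | true rewrite sym (+-suc k p) = scan-shift j k (suc p) w [] (p ∷ ms)
scan-shift j k p (c ∷ w) (_ ∷ ps) ms | false | true rewrite sym (+-suc k p) = scan-shift j k (suc p) w ps ms

scan-bounded : ∀ j p w ps ms → All (_< p) ps → All (_< p) ms →
  let (ps' , ms') = scan j p w ps ms in All (_< p + length w) ps' × All (_< p + length w) ms'
scan-bounded j p [] ps ms ps<p ms<p rewrite +-identityʳ p = ps<p , ms<p
scan-bounded j p (c ∷ w) ps ms ps<p ms<p rewrite +-suc p (length w) with c ≡ᵇ j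
... | true = scan-bounded j (suc p) w (p ∷ ps) ms (≤-refl ∷ All.map m<n⇒m<1+n ps<p) (All.map m<n⇒m<1+n ms<p)
... | false with c ≡ᵇ suc j
...   | false = scan-bounded j (suc p) w ps ms (All.map m<n⇒m<1+n ps<p) (All.map m<n⇒m<1+n ms<p)
scan-bounded j p (c ∷ w) [] ms ps<p ms<p | false | true =
  scan-bounded j (suc p) w [] (p ∷ ms) [] (≤-refl ∷ All.map m<n⇒m<1+n ms<p)
scan-bounded j p (c ∷ w) (_ ∷ ps) ms (_ ∷ ps<p) ms<p | false | true =
  scan-bounded j (suc p) w ps ms (All.map m<n⇒m<1+n ps<p) (All.map m<n⇒m<1+n ms<p)

setAtM : ℕ → List ℕ → Maybe ℕ → Maybe (List ℕ)
setAtM v w = Maybe.map (λ p → setAt p v w)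

eOp-unfold : ∀ j w → eOp j w ≡ setAtM j w (headM (proj₂ (scan j 0 w [] [])))
eOp-unfold j w with scan j 0 w [] []
... | _ , ms with headM ms
...   | nothing = refl
...   | just _ = refl

fOp-unfold : ∀ j w → fOp j w ≡ setAtM (suc j) w (lastM (proj₁ (scan j 0 w [] [])))
fOp-unfold j w with scan j 0 w [] []
... | ps , _ with lastM ps
...   | nothing = refl
...   | just _ = refl

headM-map : ∀ (f : ℕ → ℕ) l → headM (map f l) ≡ Maybe.map f (headM l)
headM-map f [] = refl
headM-map f (_ ∷ _) = refl

lastM-map : ∀ (f : ℕ → ℕ) l → lastM (map f l) ≡ Maybe.map f (lastM l)
lastM-map f [] = refl
lastM-map f (_ ∷ []) = refl
lastM-map f (_ ∷ y ∷ l) = lastM-map f (y ∷ l)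

headM-All : ∀ {P : ℕ → Set} {l} → All P l → MaybeAll.All P (headM l)
headM-All [] = MaybeAll.nothing
headM-All (px ∷ _) = MaybeAll.just px

lastM-All : ∀ {P : ℕ → Set} {l} → All P l → MaybeAll.All P (lastM l)
lastM-All [] = MaybeAll.nothing
lastM-All (px ∷ []) = MaybeAll.just px
lastM-All (_ ∷ pl@(_ ∷ _)) = lastM-All pl

setAt-++ˡ : ∀ t p v w → setAt (length t + p) v (t ++ w) ≡ t ++ setAt p v w
setAt-++ˡ [] p v w = refl
setAt-++ˡ (x ∷ t) p v w = cong (x ∷_) (setAt-++ˡ t p v w)

setAt-++ʳ : ∀ p v w t → p < length w → setAt p v (w ++ t) ≡ setAt p v w ++ t
setAt-++ʳ zero v (x ∷ w) t _ = refl
setAt-++ʳ (suc p) v (x ∷ w) t (s≤s p<w) = cong (x ∷_) (setAt-++ʳ p v w t p<w)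

setAtM-++ˡ : ∀ v t w m → setAtM v (t ++ w) (Maybe.map (length t +_) m) ≡ Maybe.map (t ++_) (setAtM v w m)
setAtM-++ˡ v t w nothing = refl
setAtM-++ˡ v t w (just p) = cong just (setAt-++ˡ t p v w)

setAtM-++ʳ : ∀ v t w {m} → MaybeAll.All (_< length w) m →
  setAtM v (w ++ t) m ≡ Maybe.map (_++ t) (setAtM v w m)
setAtM-++ʳ v t w MaybeAll.nothing = refl
setAtM-++ʳ v t w (MaybeAll.just p<w) = cong just (setAt-++ʳ _ v w t p<w)

scan-transparent-++ˡ : ∀ j t w → Transparent j t →
  scan j 0 (t ++ w) [] [] ≡ Product.map (map (length t +_)) (map (length t +_)) (scan j 0 w [] [])
scan-transparent-++ˡ j t w tr rewrite scan-++ j 0 t w [] [] | tr 0 [] [] =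
  trans (cong (λ q → scan j q w [] []) (sym (+-identityʳ (length t)))) (scan-shift j (length t) 0 w [] [])

scan-transparent-++ʳ : ∀ j t w → Transparent j t → scan j 0 (w ++ t) [] [] ≡ scan j 0 w [] []
scan-transparent-++ʳ j t w tr rewrite scan-++ j 0 w t [] [] = tr _ _ _

CommutesWithE : (List ℕ → List ℕ) → ℕ → Set
CommutesWithE κ j = ∀ w → eOp j (κ w) ≡ Maybe.map κ (eOp j w)

CommutesWithF : (List ℕ → List ℕ) → ℕ → Set
CommutesWithF κ j = ∀ w → fOp j (κ w) ≡ Maybe.map κ (fOp j w)

eOp-transparent-++ˡ : ∀ {j} t → Transparent j t → CommutesWithE (t ++_) j
eOp-transparent-++ˡ {j} t tr w rewrite eOp-unfold j (t ++ w) | eOp-unfold j w | scan-transparent-++ˡ j t w tr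
  | headM-map (length t +_) (proj₂ (scan j 0 w [] [])) = setAtM-++ˡ j t w (headM (proj₂ (scan j 0 w [] [])))

fOp-transparent-++ˡ : ∀ {j} t → Transparent j t → CommutesWithF (t ++_) j
fOp-transparent-++ˡ {j} t tr w rewrite fOp-unfold j (t ++ w) | fOp-unfold j w | scan-transparent-++ˡ j t w tr
  | lastM-map (length t +_) (proj₁ (scan j 0 w [] [])) = setAtM-++ˡ (suc j) t w (lastM (proj₁ (scan j 0 w [] [])))

eOp-transparent-++ʳ : ∀ {j} t → Transparent j t → CommutesWithE (_++ t) j
eOp-transparent-++ʳ {j} t tr w rewrite eOp-unfold j (w ++ t) | eOp-unfold j w | scan-transparent-++ʳ j t w tr =
  setAtM-++ʳ j t w (headM-All (proj₂ (scan-bounded j 0 w [] [] [] [])))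

fOp-transparent-++ʳ : ∀ {j} t → Transparent j t → CommutesWithF (_++ t) j
fOp-transparent-++ʳ {j} t tr w rewrite fOp-unfold j (w ++ t) | fOp-unfold j w | scan-transparent-++ʳ j t w tr =
  setAtM-++ʳ (suc j) t w (lastM-All (proj₁ (scan-bounded j 0 w [] [] [] [])))

isNothing-map : ∀ {A B : Set} (f : A → B) m → isNothing (Maybe.map f m) ≡ isNothing m
isNothing-map f nothing = refl
isNothing-map f (just _) = refl

module _ {κ : List ℕ → List ℕ} where

  firstE-commute : ∀ js → All (CommutesWithE κ) js →
    ∀ w → firstE js (κ w) ≡ Maybe.map (Product.map₂ κ) (firstE js w)
  firstE-commute [] _ w = refl
  firstE-commute (j ∷ js) (κe ∷ κes) w rewrite κe w with eOp j w
  ... | just _ = refl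
  ... | nothing = firstE-commute js κes w

  isHW-commute : ∀ ℓ → All (CommutesWithE κ) (range 1 (ℓ ∸ 1)) → ∀ w → isHW ℓ (κ w) ≡ isHW ℓ w
  isHW-commute ℓ κes w = go (range 1 (ℓ ∸ 1)) κes
    where
    go : ∀ js → All (CommutesWithE κ) js →
      allB (λ j → isNothing (eOp j (κ w))) js ≡ allB (λ j → isNothing (eOp j w)) js
    go [] _ = refl
    go (j ∷ js) (κe ∷ κes) rewrite κe w | isNothing-map κ (eOp j w) = cong (isNothing (eOp j w) ∧_) (go js κes)

  hwPath-commute : ∀ ℓ → All (CommutesWithE κ) (range 1 (ℓ ∸ 1)) →
    ∀ k w acc → hwPath k ℓ (κ w) acc ≡ Product.map₁ κ (hwPath k ℓ w acc)
  hwPath-commute ℓ κes zero w acc = refl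
  hwPath-commute ℓ κes (suc k) w acc rewrite firstE-commute (range 1 (ℓ ∸ 1)) κes w with firstE (range 1 (ℓ ∸ 1)) w
  ... | nothing = refl
  ... | just (j , w') = hwPath-commute ℓ κes k w' (j ∷ acc)

  applyFs-commute : ∀ path → All (CommutesWithF κ) path →
    ∀ w → applyFs path (κ w) ≡ Maybe.map κ (applyFs path w)
  applyFs-commute [] _ w = refl
  applyFs-commute (j ∷ path) (κf ∷ κfs) w rewrite κf w with fOp j w
  ... | nothing = refl
  ... | just w' = applyFs-commute path κfs w'

firstE-just : ∀ js w {j w'} → firstE js w ≡ just (j , w') → j ∈ js × eOp j w ≡ just w'
firstE-just (i ∷ js) w eq with eOp i w in eOp≡
firstE-just (i ∷ js) w refl | just _ = here refl , eOp≡
... | nothing = Product.map₁ there (firstE-just js w eq)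

firstE-nothing : ∀ js w → firstE js w ≡ nothing → allB (λ j → isNothing (eOp j w)) js ≡ true
firstE-nothing [] w _ = refl
firstE-nothing (j ∷ js) w eq with eOp j w
... | nothing = firstE-nothing js w eq

firstE-[] : ∀ js → firstE js [] ≡ nothing
firstE-[] [] = refl
firstE-[] (_ ∷ js) = firstE-[] js

applyFs-cons : ∀ {j acc w w'} → fOp j w ≡ just w' → applyFs (j ∷ acc) w ≡ applyFs acc w'
applyFs-cons f≡ rewrite f≡ = refl

hwPath-All : ∀ {Q : ℕ → Set} ℓ k w acc → All Q (range 1 (ℓ ∸ 1)) → All Q acc →
  All Q (proj₂ (hwPath k ℓ w acc))
hwPath-All ℓ zero w acc _ q-acc = q-acc
hwPath-All ℓ (suc k) w acc q-js q-acc with firstE (range 1 (ℓ ∸ 1)) w in eq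
... | nothing = q-acc
... | just (j , w') = hwPath-All ℓ k w' (j ∷ acc) q-js (All.lookup q-js (proj₁ (firstE-just _ w eq)) ∷ q-acc)

-- Columns under ė_j and ḟ_j

data Core (j : ℕ) : List ℕ → Set where
  none  : Core j []
  plus  : Core j (j ∷ [])
  minus : Core j (suc j ∷ [])
  pair  : Core j (j ∷ suc j ∷ [])

record Split (j : ℕ) (c : List ℕ) : Set where
  constructor split
  field
    {lo mid hi} : List ℕ
    lo<j : All (_< j) lo
    1+j<hi : All (suc j <_) hi
    core : Core j mid
    c≡ : c ≡ lo ++ mid ++ hi

split-increasing : ∀ j c → Increasing c → Split j c
split-increasing j [] _ = split [] [] none refl
split-increasing j (x ∷ c) inc with <-cmp x j
... | tri< x<j _ _ with split-increasing j c (Linked.tail inc)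
...   | split lo<j 1+j<hi core refl = split (x<j ∷ lo<j) 1+j<hi core refl
split-increasing j (x ∷ []) _ | tri≈ _ refl _ = split [] [] plus refl
split-increasing j (x ∷ y ∷ c) (x<y ∷ inc) | tri≈ _ refl _ with y ≟ suc x
... | yes refl = split [] (increasing⇒head< inc) pair refl
... | no y≢1+x = split [] (1+x<y ∷ All.map (<-trans 1+x<y) (increasing⇒head< inc)) plus refl
  where 1+x<y = ≤∧≢⇒< x<y (y≢1+x ∘ sym)
split-increasing j (x ∷ c) inc | tri> _ _ j<x with x ≟ suc j
... | yes refl = split [] (increasing⇒head< inc) minus refl
... | no x≢1+j = split [] (1+j<x ∷ All.map (<-trans 1+j<x) (increasing⇒head< inc)) none refl
  where 1+j<x = ≤∧≢⇒< j<x (x≢1+j ∘ sym)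

scan-split : ∀ {j lo} mid {hi} → All (_< j) lo → All (suc j <_) hi →
  scan j 0 (lo ++ mid ++ hi) [] [] ≡ scan j (length lo) mid [] []
scan-split {j} {lo} mid {hi} lo<j 1+j<hi
  rewrite scan-++ j 0 lo (mid ++ hi) [] [] | avoiding⇒transparent (All.map <⇒avoids lo<j) 0 [] []
        | scan-++ j (length lo) mid hi [] [] = avoiding⇒transparent (All.map >⇒avoids 1+j<hi) _ _ _

setAt-middle : ∀ lo v x hi → setAt (length lo) v (lo ++ x ∷ hi) ≡ lo ++ v ∷ hi
setAt-middle [] v x hi = refl
setAt-middle (y ∷ lo) v x hi = cong (y ∷_) (setAt-middle lo v x hi)

lowered : ∀ {j mid} → Core j mid → Maybe (List ℕ)
lowered {j} minus = just (j ∷ [])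
lowered _ = nothing

eOp-split : ∀ {j lo mid hi} → All (_< j) lo → All (suc j <_) hi → (core : Core j mid) →
  eOp j (lo ++ mid ++ hi) ≡ Maybe.map (λ m → lo ++ m ++ hi) (lowered core)
eOp-split {j} {lo} {mid} {hi} lo<j 1+j<hi core
  rewrite eOp-unfold j (lo ++ mid ++ hi) | scan-split mid lo<j 1+j<hi with core
... | none = refl
... | plus rewrite ≡ᵇ-refl j = refl
... | minus rewrite 1+n≡ᵇn≡false j | ≡ᵇ-refl j = cong just (setAt-middle lo j (suc j) hi)
... | pair rewrite pair-transparent j (length lo) [] [] = refl

fOp-split-plus : ∀ {j lo hi} → All (_< j) lo → All (suc j <_) hi →
  fOp j (lo ++ j ∷ hi) ≡ just (lo ++ suc j ∷ hi)
fOp-split-plus {j} {lo} {hi} lo<j 1+j<hi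
  rewrite fOp-unfold j (lo ++ j ∷ hi) | scan-split (j ∷ []) lo<j 1+j<hi | ≡ᵇ-refl j =
    cong just (setAt-middle lo (suc j) j hi)

lookupM : List ℕ → ℕ → Maybe ℕ
lookupM [] i = nothing
lookupM (x ∷ w) zero = just x
lookupM (x ∷ w) (suc i) = lookupM w i

UnmatchedPlus : ℕ → List ℕ → ℕ → Set
UnmatchedPlus j w i = lookupM w i ≡ just j × lookupM w (suc i) ≢ just (suc j)

PlusOrigin : ℕ → ℕ → List ℕ → List ℕ → ℕ → Set
PlusOrigin j q w ps p = p ∈ ps ⊎ ∃ λ i → p ≡ q + i × UnmatchedPlus j w i

PlusOrigin-∷ : ∀ {j q c w ps p} → PlusOrigin j (suc q) w ps p → PlusOrigin j q (c ∷ w) ps p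
PlusOrigin-∷ {q = q} = Sum.map₂ λ (i , p≡ , u) → suc i , trans p≡ (sym (+-suc q i)) , u

PlusesOriginate : ℕ → ℕ → List ℕ → Set
PlusesOriginate j q w = ∀ ps ms → All (PlusOrigin j q w ps) (proj₁ (scan j q w ps ms))

-- an unmatched j cannot be followed by j + 1, since that letter would cancel it at once
pluses-unmatched-∷ : ∀ {j q c w} → PlusesOriginate j (suc q) w → PlusesOriginate j (suc (suc q)) (drop 1 w) →
  PlusesOriginate j q (c ∷ w)
pluses-unmatched-∷ {j} {q} {c} {w} ih _ ps ms with c ≟ j
pluses-unmatched-∷ {j} {q} {c} {w} ih _ ps ms | no c≢j rewrite ≢⇒≡ᵇ≡false c≢j with c ≡ᵇ suc j
... | false = All.map PlusOrigin-∷ (ih ps ms)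
... | true with ps
...   | [] = All.map PlusOrigin-∷ (ih [] (q ∷ ms))
...   | _ ∷ ps' = All.map (Sum.map₁ there ∘ PlusOrigin-∷) (ih ps' ms)
pluses-unmatched-∷ {j} {q} {w = []} ih _ ps ms | yes refl rewrite ≡ᵇ-refl j =
  inj₂ (0 , sym (+-identityʳ q) , refl , λ ()) ∷ All.tabulate inj₁
pluses-unmatched-∷ {j} {q} {w = c' ∷ w} ih ih₂ ps ms | yes refl with c' ≟ suc j
... | yes refl rewrite ≡ᵇ-refl j | 1+n≡ᵇn≡false j = All.map (PlusOrigin-∷ ∘ PlusOrigin-∷) (ih₂ ps ms)
... | no c'≢1+j rewrite ≡ᵇ-refl j = All.map push (ih (q ∷ ps) ms)
  where
  push : ∀ {p} → PlusOrigin j (suc q) (c' ∷ w) (q ∷ ps) p → PlusOrigin j q (j ∷ c' ∷ w) ps p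
  push (inj₁ (here refl)) = inj₂ (0 , sym (+-identityʳ q) , refl , c'≢1+j ∘ Maybe.just-injective)
  push (inj₁ (there p∈)) = inj₁ p∈
  push (inj₂ o) = PlusOrigin-∷ (inj₂ o)

pluses-unmatched : ∀ j q w → PlusesOriginate j q w
pluses-unmatched j q [] ps ms = All.tabulate inj₁
pluses-unmatched j q (_ ∷ []) =
  pluses-unmatched-∷ (pluses-unmatched j (suc q) []) (pluses-unmatched j (suc (suc q)) [])
pluses-unmatched j q (_ ∷ c' ∷ w) =
  pluses-unmatched-∷ (pluses-unmatched j (suc q) (c' ∷ w)) (pluses-unmatched j (suc (suc q)) w)

fOp-raises-unmatched : ∀ {j w w'} → fOp j w ≡ just w' →
  ∃ λ i → w' ≡ setAt i (suc j) w × UnmatchedPlus j w i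
fOp-raises-unmatched {j} {w} f≡ rewrite fOp-unfold j w
  with lastM (proj₁ (scan j 0 w [] [])) | lastM-All (pluses-unmatched j 0 w [] [])
fOp-raises-unmatched refl | just i | MaybeAll.just (inj₂ (i , refl , unmatched)) = i , refl , unmatched

take-setAt : ∀ b p v w → take b (setAt p v w) ≡ setAt p v (take b w)
take-setAt zero p v w = refl
take-setAt (suc b) p v [] = refl
take-setAt (suc b) zero v (x ∷ w) = refl
take-setAt (suc b) (suc p) v (x ∷ w) = cong (x ∷_) (take-setAt b p v w)

lookupM-take : ∀ b w i {x} → lookupM (take b w) i ≡ just x → lookupM w i ≡ just x
lookupM-take (suc b) (y ∷ w) zero eq = eq
lookupM-take (suc b) (y ∷ w) (suc i) eq = lookupM-take b w i eq

All-setAt : ∀ {P : ℕ → Set} {v} c i → (∀ {y} → lookupM c i ≡ just y → P y → P v) →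
  All P c → All P (setAt i v c)
All-setAt [] i _ [] = []
All-setAt (x ∷ c) zero Pv (px ∷ pc) = Pv refl px ∷ pc
All-setAt (x ∷ c) (suc i) Pv (px ∷ pc) = px ∷ All-setAt c i Pv pc

raise-increasing : ∀ {j} c i → (∀ {y} → lookupM c i ≡ just y → y ≡ j) → lookupM c (suc i) ≢ just (suc j) →
  Increasing c → Increasing (setAt i (suc j) c)
raise-increasing [] i _ _ inc = inc
raise-increasing (x ∷ []) zero _ _ _ = [-]
raise-increasing (x ∷ y ∷ c) zero at-i at-1+i (x<y ∷ inc) with at-i refl
... | refl = ≤∧≢⇒< x<y (at-1+i ∘ cong just ∘ sym) ∷ inc
raise-increasing (x ∷ c) (suc i) at-i at-1+i inc = head<⇒increasing
  (All-setAt c i (λ at≡ x<y → <-trans x<y (subst (_< _) (sym (at-i at≡)) (n<1+n _))) (increasing⇒head< inc))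
  (raise-increasing c i at-i at-1+i (Linked.tail inc))

increasing-head≤ : ∀ M b x e → Increasing (x ∷ e) → All (_≤ M) (x ∷ e) → b + length (x ∷ e) ≡ suc M →
  x ≤ b
increasing-head≤ M b x e inc ≤M b+len≡ = +-cancelʳ-≤ (length e) x b (≤-pred
  (subst (suc (x + length e) ≤_) (trans (sym b+len≡) (+-suc b (length e)))
         (increasing-head+length< x e inc (All.map s≤s ≤M))))

rows-below-top : ∀ M b {e} → Increasing e → All (_≤ M) e → b + length e ≡ suc M →
  okRows e (iota b (length e)) ≡ true
rows-below-top M b {[]} _ _ _ = refl
rows-below-top M b {x ∷ e} inc ≤M b+len≡ rewrite ≤⇒≤ᵇ≡true (increasing-head≤ M b x e inc ≤M b+len≡) =
  rows-below-top M (suc b) (Linked.tail inc) (All.tail ≤M) (trans (sym (+-suc b (length e))) b+len≡)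

module _ (ℓ : ℕ) where

  Col : Column → Set
  Col = IsColumn ℓ

  Index : ℕ → Set
  Index j = 1 ≤ j × suc j ≤ ℓ

  indices : List ℕ
  indices = range 1 (ℓ ∸ 1)

  indices-Index : All Index indices
  indices-Index rewrite range≡iota 1 (ℓ ∸ 1) =
    All.tabulate λ j∈ → let 1≤j , j<ℓ = ∈-iota⁻ 1 (ℓ ∸ 1) j∈ in 1≤j , <-bound ℓ 1≤j j<ℓ
    where
    <-bound : ∀ n {j} → 1 ≤ j → j < 1 + (n ∸ 1) → suc j ≤ n
    <-bound zero 1≤j j<1 = contradiction j<1 (≤⇒≯ 1≤j)
    <-bound (suc n) _ j<1+n = j<1+n

  record RaisedBy (j : ℕ) (c' c : Column) : Set where
    field
      column : Col c'
      length≡ : length c' ≡ length c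
      1+sum≡ : suc (sum c') ≡ sum c
      f-inverse : fOp j c' ≡ just c

  eOp-column : ∀ {j c c'} → Index j → Col c → eOp j c ≡ just c' → RaisedBy j c' c
  eOp-column {j} (1≤j , 1+j≤ℓ) (inc , bounds) e≡ with split-increasing j _ inc
  ... | split {lo} {hi = hi} lo<j 1+j<hi core refl with core | trans (sym (eOp-split lo<j 1+j<hi core)) e≡
  ...   | minus | refl = record
    { column = increasing-insert lo inc-lo lo<j
                 (head<⇒increasing (All.map (<-trans (n<1+n j)) 1+j<hi) (Linked.tail inc-hi))
             , All.++⁺ bounds-lo ((1≤j , <⇒≤ 1+j≤ℓ) ∷ All.tail bounds-hi)
    ; length≡ = trans (List.length-++ lo) (sym (List.length-++ lo))
    ; 1+sum≡ = trans (cong suc (sum-++ lo (j ∷ hi)))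
                     (trans (sym (+-suc (sum lo) (j + sum hi))) (sym (sum-++ lo (suc j ∷ hi))))
    ; f-inverse = fOp-split-plus lo<j 1+j<hi
    }
    where
    inc-lo = proj₁ (increasing-++⁻ lo inc)
    inc-hi = proj₂ (increasing-++⁻ lo inc)
    bounds-lo = All.++⁻ˡ lo bounds
    bounds-hi = All.++⁻ʳ lo bounds

  record HighestWeightLift (c : Column) (acc h path : List ℕ) : Set where
    field
      column : Col h
      length≡ : length h ≡ length c
      highest : firstE indices h ≡ nothing
      lifts : applyFs path h ≡ applyFs acc c

  column-sum≤0 : ∀ {c} → Col c → sum c ≤ 0 → c ≡ []
  column-sum≤0 {[]} _ _ = refl
  column-sum≤0 {x ∷ c} (_ , (1≤x , _) ∷ _) sum≤0 =
    contradiction (≤-trans (m≤m+n x (sum c)) sum≤0) (<⇒≱ 1≤x)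

  -- each ė_j lowers the letter sum by one, so fuel sum c suffices to reach the highest weight
  hwPath-column : ∀ k c acc → Col c → sum c ≤ k → uncurry (HighestWeightLift c acc) (hwPath k ℓ c acc)
  hwPath-column zero c acc col sum≤0 with column-sum≤0 col sum≤0
  ... | refl = record { column = col ; length≡ = refl ; highest = firstE-[] indices ; lifts = refl }
  hwPath-column (suc k) c acc col sum≤ with firstE indices c in eq
  ... | nothing = record { column = col ; length≡ = refl ; highest = eq ; lifts = refl }
  ... | just (j , c') with firstE-just indices c eq
  ...   | j∈ , e≡ = record
    { column = column lift
    ; length≡ = trans (length≡ lift) (length≡ raised)
    ; highest = highest lift
    ; lifts = trans (lifts lift) (applyFs-cons (f-inverse raised))
    }
    where
    open RaisedBy
    open HighestWeightLift
    raised = eOp-column (All.lookup indices-Index j∈) col e≡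
    lift = hwPath-column k c' (j ∷ acc) (column raised)
             (≤-pred (subst (_≤ suc k) (sym (1+sum≡ raised)) sum≤))

  -- The full column

  full : Column
  full = fullColumn ℓ

  full≡iota : full ≡ iota 1 ℓ
  full≡iota = range≡iota 1 ℓ

  length-full : length full ≡ ℓ
  length-full = trans (cong length full≡iota) (length-iota 1 ℓ)

  bounded⇒∈iota : ∀ {k} → 1 ≤ k × k ≤ ℓ → k ∈ iota 1 ℓ
  bounded⇒∈iota (1≤k , k≤ℓ) = ∈-iota⁺ 1 ℓ 1≤k (s≤s k≤ℓ)

  ∈iota⇒bounded : ∀ {k} → k ∈ iota 1 ℓ → 1 ≤ k × k ≤ ℓ
  ∈iota⇒bounded = Product.map₂ ≤-pred ∘ ∈-iota⁻ 1 ℓ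

  bounded⇒∈full : ∀ {k} → 1 ≤ k × k ≤ ℓ → k ∈ full
  bounded⇒∈full = subst (_ ∈_) (sym full≡iota) ∘ bounded⇒∈iota

  full-column : Col full
  full-column = subst Col (sym full≡iota) (iota-increasing 1 ℓ , All.tabulate ∈iota⇒bounded)

  full-unique : ∀ {c} → Col c → length c ≡ ℓ → c ≡ full
  full-unique (inc , bounds) len =
    trans (increasing-⊆-iota 1 ℓ inc (All.map bounded⇒∈iota bounds) len) (sym full≡iota)

  full-transparent : ∀ {j} → Index j → Transparent j full
  full-transparent (1≤j , 1+j≤ℓ) rewrite full≡iota = iota-transparent 1 ℓ 1≤j (s≤s 1+j≤ℓ)

  length-column≤ : ∀ {c} → Col c → length c ≤ ℓ
  length-column≤ {[]} _ = z≤n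
  length-column≤ {x ∷ c} (inc , bounds@((1≤x , _) ∷ _)) = ≤-pred (≤-trans (s≤s (+-monoˡ-≤ (length c) 1≤x))
    (increasing-head+length< x c inc (All.map (s≤s ∘ proj₂) bounds)))

  ∈-columnsOfSize⁻ : ∀ {b c} → c ∈ columnsOfSize ℓ b → Col c × length c ≡ b
  ∈-columnsOfSize⁻ {b} c∈ with ∈-filterB⁻ (λ c → length c ≡ᵇ b) (subs full) c∈
  ... | c∈subs , len with ∈-subs⁻ 1 ℓ (subst (λ l → _ ∈ subs l) full≡iota c∈subs)
  ...   | inc , c⊆ = (inc , All.map ∈iota⇒bounded c⊆) , ≡ᵇ≡true⇒≡ len

  ∈-columnsOfSize⁺ : ∀ {c} → Col c → c ∈ columnsOfSize ℓ (length c)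
  ∈-columnsOfSize⁺ {c} (inc , bounds) = ∈-filterB⁺ (λ d → length d ≡ᵇ length c) (subs full)
    (subst (λ l → c ∈ subs l) (sym full≡iota) (∈-subs⁺ 1 ℓ inc (All.map bounded⇒∈iota bounds)))
    (≡ᵇ-refl (length c))

  ∈-candidates⁻ : ∀ {a b z} → z ∈ candidates ℓ a b →
    ∃ λ c₁ → ∃ λ c₂ → z ≡ c₁ ++ c₂ × (Col c₁ × length c₁ ≡ b) × (Col c₂ × length c₂ ≡ a)
  ∈-candidates⁻ {a} {b} z∈
    with find (∈-concatMap⁻ (λ c₁ → map (c₁ ++_) (columnsOfSize ℓ a)) {xs = columnsOfSize ℓ b} z∈)
  ... | c₁ , c₁∈ , z∈' with ∈-map⁻ (c₁ ++_) z∈'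
  ...   | c₂ , c₂∈ , z≡ = c₁ , c₂ , z≡ , ∈-columnsOfSize⁻ c₁∈ , ∈-columnsOfSize⁻ c₂∈

  ∈-candidates⁺ : ∀ {a b c₁ c₂} → Col c₁ → Col c₂ → length c₂ ≡ a → length c₁ ≡ b →
    c₁ ++ c₂ ∈ candidates ℓ a b
  ∈-candidates⁺ {c₁ = c₁} {c₂} col₁ col₂ refl refl =
    ∈-concatMap⁺ (λ d → map (d ++_) (columnsOfSize ℓ (length c₂)))
      (lose (∈-columnsOfSize⁺ col₁) (∈-map⁺ (c₁ ++_) (∈-columnsOfSize⁺ col₂)))

  SameWeight : List ℕ → List ℕ → Set
  SameWeight u w = ∀ {k} → k ∈ full → count k u ≡ count k w

  listEq-weight⇒SameWeight : ∀ {u w} → listEq (weight ℓ u) (weight ℓ w) ≡ true → SameWeight u w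
  listEq-weight⇒SameWeight {u} {w} eq =
    map≡⇒pointwise (λ k → count k u) (λ k → count k w) full (listEq-sound _ _ eq)

  weight-++-comm : ∀ u w → weight ℓ (u ++ w) ≡ weight ℓ (w ++ u)
  weight-++-comm u w = List.map-cong (λ k → count-++-comm k u w) full

  SameWeight⇒≡ : ∀ {c d} → Col c → Col d → SameWeight c d → c ≡ d
  SameWeight⇒≡ (inc-c , bounds-c) (inc-d , bounds-d) =
    increasing-count-injective inc-c inc-d (All.map bounded⇒∈full bounds-c) (All.map bounded⇒∈full bounds-d)

  two-columns-with-full-unique : ∀ {c₁ c₂ c₁' c₂'} → Col c₁ → Col c₂ → Col c₁' → Col c₂' →
    length c₁ ≡ length c₁' → length c₂ ≡ length c₂' → c₁ ≡ full ⊎ c₂ ≡ full →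
    SameWeight (c₁ ++ c₂) (c₁' ++ c₂') → c₁ ++ c₂ ≡ c₁' ++ c₂'
  two-columns-with-full-unique {c₂ = c₂} {c₂' = c₂'} _ col₂ col₁' col₂' len₁ _ (inj₁ refl) same
    with full-unique col₁' (trans (sym len₁) length-full)
  ... | refl = cong (full ++_) (SameWeight⇒≡ col₂ col₂' λ {k} k∈ → +-cancelˡ-≡ (count k full) _ _
                 (trans (sym (count-++ k full c₂)) (trans (same k∈) (count-++ k full c₂'))))
  two-columns-with-full-unique {c₁} {c₁' = c₁'} col₁ _ col₁' col₂' _ len₂ (inj₂ refl) same
    with full-unique col₂' (trans (sym len₂) length-full)
  ... | refl = cong (_++ full) (SameWeight⇒≡ col₁ col₁' λ {k} k∈ → +-cancelʳ-≡ (count k full) _ _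
                 (trans (sym (count-++ k c₁ full)) (trans (same k∈) (count-++ k c₁' full))))

  -- The combinatorial R-matrix

  Matches : List ℕ → List ℕ → Bool
  Matches h c = isHW ℓ c ∧ listEq (weight ℓ c) (weight ℓ h)

  Matches⇒SameWeight : ∀ {h z} → Matches h z ≡ true → SameWeight z h
  Matches⇒SameWeight {h} {z} = listEq-weight⇒SameWeight {z} {h} ∘ proj₂ ∘ ∧≡true {isHW ℓ z}

  hw : Column → Column → List ℕ × List ℕ
  hw d₁ d₂ = hwPath (length (d₁ ++ d₂) * ℓ) ℓ (d₁ ++ d₂) []

  Rpair-swap : ∀ d₁ d₂ {c} →
    findFirst (Matches (proj₁ (hw d₁ d₂))) (candidates ℓ (length d₁) (length d₂)) ≡ just c →
    applyFs (proj₂ (hw d₁ d₂)) c ≡ just (d₂ ++ d₁) → Rpair ℓ d₁ d₂ ≡ (d₂ , d₁)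
  Rpair-swap d₁ d₂ found lifted with hw d₁ d₂
  ... | h , path rewrite found | lifted = cong₂ _,_ (take-length-++ d₂ d₁) (drop-length-++ d₂ d₁)

  full-++ˡ-commutesWithE : ∀ {js} → All Index js → All (CommutesWithE (full ++_)) js
  full-++ˡ-commutesWithE = All.map (eOp-transparent-++ˡ full ∘ full-transparent)

  full-++ʳ-commutesWithE : ∀ {js} → All Index js → All (CommutesWithE (_++ full)) js
  full-++ʳ-commutesWithE = All.map (eOp-transparent-++ʳ full ∘ full-transparent)

  full-++ˡ-commutesWithF : ∀ {js} → All Index js → All (CommutesWithF (full ++_)) js
  full-++ˡ-commutesWithF = All.map (fOp-transparent-++ˡ full ∘ full-transparent)

  full-++ʳ-commutesWithF : ∀ {js} → All Index js → All (CommutesWithF (_++ full)) js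
  full-++ʳ-commutesWithF = All.map (fOp-transparent-++ʳ full ∘ full-transparent)

  path-Index : ∀ k w → All Index (proj₂ (hwPath k ℓ w []))
  path-Index k w = hwPath-All ℓ k w [] indices-Index []

  sum≤length*ℓ : ∀ {c} → Col c → sum c ≤ length c * ℓ
  sum≤length*ℓ {[]} _ = z≤n
  sum≤length*ℓ {x ∷ c} (inc , (_ , x≤ℓ) ∷ bounds) =
    +-mono-≤ x≤ℓ (sum≤length*ℓ (Linked.tail inc , bounds))

  highest-weight-of-column : ∀ {c} n → Col c → length c ≤ n →
    uncurry (HighestWeightLift c []) (hwPath (n * ℓ) ℓ c [])
  highest-weight-of-column n col len≤ =
    hwPath-column (n * ℓ) _ [] col (≤-trans (sum≤length*ℓ col) (*-monoˡ-≤ ℓ len≤))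

  isHW-highest : ∀ {h} → firstE indices h ≡ nothing → isHW ℓ h ≡ true
  isHW-highest = firstE-nothing indices _

  Rpair-full-left : ∀ {e} → Col e → Rpair ℓ full e ≡ (e , full)
  Rpair-full-left {e} col = Rpair-swap full e found lifted
    where
    open HighestWeightLift
    K = length (full ++ e)
    h = proj₁ (hwPath (K * ℓ) ℓ e [])
    path = proj₂ (hwPath (K * ℓ) ℓ e [])
    lift = highest-weight-of-column K col (List.length-++-≤ʳ e {full})
    hw≡ : hw full e ≡ (full ++ h , path)
    hw≡ = hwPath-commute ℓ (full-++ˡ-commutesWithE indices-Index) (K * ℓ) e []
    matches : Matches (full ++ h) (h ++ full) ≡ true
    matches rewrite isHW-commute ℓ (full-++ʳ-commutesWithE indices-Index) h | isHW-highest (highest lift)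
      | weight-++-comm h full = listEq-refl (weight ℓ (full ++ h))
    unique : ∀ {z} → z ∈ candidates ℓ (length full) (length e) → Matches (full ++ h) z ≡ true → z ≡ h ++ full
    unique z∈ m with ∈-candidates⁻ z∈
    ... | c₁ , c₂ , refl , (col₁ , len₁) , (col₂ , len₂) =
      two-columns-with-full-unique col₁ col₂ (column lift) full-column (trans len₁ (sym (length≡ lift))) len₂
        (inj₂ (full-unique col₂ (trans len₂ length-full)))
        (λ {k} k∈ → trans (Matches⇒SameWeight {full ++ h} m k∈) (count-++-comm k full h))
    found : findFirst (Matches (proj₁ (hw full e))) (candidates ℓ (length full) (length e)) ≡ just (h ++ full)
    found rewrite hw≡ =
      findFirst-unique _ _ (∈-candidates⁺ (column lift) full-column refl (length≡ lift)) matches unique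
    lifted : applyFs (proj₂ (hw full e)) (h ++ full) ≡ just (e ++ full)
    lifted rewrite hw≡ = trans (applyFs-commute path (full-++ʳ-commutesWithF (path-Index (K * ℓ) e)) h)
                               (cong (Maybe.map (_++ full)) (lifts lift))

  Rpair-full-right : ∀ {d} → Col d → Rpair ℓ d full ≡ (full , d)
  Rpair-full-right {d} col = Rpair-swap d full found lifted
    where
    open HighestWeightLift
    K = length (d ++ full)
    h = proj₁ (hwPath (K * ℓ) ℓ d [])
    path = proj₂ (hwPath (K * ℓ) ℓ d [])
    lift = highest-weight-of-column K col (List.length-++-≤ˡ d)
    hw≡ : hw d full ≡ (h ++ full , path)
    hw≡ = hwPath-commute ℓ (full-++ʳ-commutesWithE indices-Index) (K * ℓ) d []
    matches : Matches (h ++ full) (full ++ h) ≡ true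
    matches rewrite isHW-commute ℓ (full-++ˡ-commutesWithE indices-Index) h | isHW-highest (highest lift)
      | weight-++-comm full h = listEq-refl (weight ℓ (h ++ full))
    unique : ∀ {z} → z ∈ candidates ℓ (length d) (length full) → Matches (h ++ full) z ≡ true → z ≡ full ++ h
    unique z∈ m with ∈-candidates⁻ z∈
    ... | c₁ , c₂ , refl , (col₁ , len₁) , (col₂ , len₂) =
      two-columns-with-full-unique col₁ col₂ full-column (column lift) len₁ (trans len₂ (sym (length≡ lift)))
        (inj₁ (full-unique col₁ (trans len₁ length-full)))
        (λ {k} k∈ → trans (Matches⇒SameWeight {h ++ full} m k∈) (count-++-comm k h full))
    found : findFirst (Matches (proj₁ (hw d full))) (candidates ℓ (length d) (length full)) ≡ just (full ++ h)
    found rewrite hw≡ =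
      findFirst-unique _ _ (∈-candidates⁺ full-column (column lift) (length≡ lift) refl) matches unique
    lifted : applyFs (proj₂ (hw d full)) (full ++ h) ≡ just (full ++ d)
    lifted rewrite hw≡ = trans (applyFs-commute path (full-++ˡ-commutesWithF (path-Index (K * ℓ) d)) h)
                               (cong (Maybe.map (full ++_)) (lifts lift))

  fOp-column-prefix : ∀ {j} b {w w'} → Index j → Col (take b w) → fOp j w ≡ just w' → Col (take b w')
  fOp-column-prefix {j} b {w} (_ , 1+j≤ℓ) (inc , bounds) f≡ with fOp-raises-unmatched f≡
  ... | i , refl , at-i , at-1+i rewrite take-setAt b i (suc j) w =
    raise-increasing (take b w) i (λ at≡ → Maybe.just-injective (trans (sym (lookupM-take b w i at≡)) at-i))
                     (at-1+i ∘ lookupM-take b w (suc i)) inc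
    , All-setAt (take b w) i (λ _ _ → s≤s z≤n , 1+j≤ℓ) bounds

  applyFs-column-prefix : ∀ path b {c y} → All Index path → Col (take b c) → applyFs path c ≡ just y →
    Col (take b y)
  applyFs-column-prefix [] b _ col refl = col
  applyFs-column-prefix (j ∷ path) b {c} (j-idx ∷ path-idx) col lifted with fOp j c in f≡
  ... | just c' = applyFs-column-prefix path b path-idx (fOp-column-prefix b j-idx col f≡) lifted

  Rpair-column : ∀ {a} e → Col a → Col (proj₁ (Rpair ℓ a e))
  Rpair-column {a} e col with hw a e | path-Index (length (a ++ e) * ℓ) (a ++ e)
  ... | h , path | path-idx with findFirst (Matches h) (candidates ℓ (length a) (length e)) in found
  ...   | nothing = col
  ...   | just c with applyFs path c in lifted
  ...     | nothing = col
  ...     | just y with ∈-candidates⁻ (findFirst-∈ _ _ found)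
  ...       | c₁ , c₂ , refl , (col₁ , len₁) , _ = applyFs-column-prefix path (length e) path-idx
    (subst (λ b → Col (take b (c₁ ++ c₂))) len₁ (subst Col (sym (take-length-++ c₁ c₂)) col₁)) lifted

  -- Energy

  rows-fit-full : ∀ {e} → Col e → okRows e (drop (ℓ ∸ length e) full) ≡ true
  rows-fit-full {e} col@(inc , bounds)
    rewrite full≡iota | drop-iota (ℓ ∸ length e) 1 ℓ | m∸[m∸n]≡n (length-column≤ col) =
    rows-below-top ℓ (suc (ℓ ∸ length e)) inc (All.map proj₂ bounds) (cong suc (m∸n+n≡m (length-column≤ col)))

  Hgeq-full-left : ∀ {e} → Col e → Hgeq full e ≡ 0
  Hgeq-full-left {e} col rewrite length-full | rows-fit-full col | m∸n+n≡m (length-column≤ col) = n∸n≡0 ℓ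

  H-full-left : ∀ {e} → Col e → H ℓ full e ≡ 0
  H-full-left {e} col rewrite ≤⇒≤ᵇ≡true (subst (length e ≤_) (sym length-full) (length-column≤ col)) =
    Hgeq-full-left col

  H-full-right : ∀ {d} → Col d → H ℓ d full ≡ 0
  H-full-right {d} col with length full ≤ᵇ length d in full≤d
  ... | true rewrite full-unique col (≤-antisym (length-column≤ col) (subst (_≤ length d) length-full
                       (≤ᵇ⇒≤ _ _ (Equivalence.from T-≡ full≤d)))) = Hgeq-full-left full-column
  ... | false rewrite Rpair-full-right col = Hgeq-full-left col

  Rfirst : Column → Column → Column
  Rfirst a e = proj₁ (Rpair ℓ a e)

  -- entry j is the factor d_j carried to the front by R_{j-1}, …, R_1, as in the energy with i = 0
  toFront : List Column → List Column
  toFront [] = []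
  toFront (a ∷ y) = a ∷ map (Rfirst a) (toFront y)

  chain≡foldr : ∀ i j x → chain ℓ i j x ≡ foldr (applyR ℓ) x (range (suc i) (j ∸ 1))
  chain≡foldr i j x = List.reverse-foldl (λ y m → applyR ℓ m y) x (range (suc i) (j ∸ 1))

  foldr-applyR-∷ : ∀ d y L → All (1 ≤_) L → foldr (applyR ℓ) (d ∷ y) (map suc L) ≡ d ∷ foldr (applyR ℓ) y L
  foldr-applyR-∷ d y [] [] = refl
  foldr-applyR-∷ d y (suc m ∷ L) (s≤s z≤n ∷ L≥1) rewrite foldr-applyR-∷ d y L L≥1 = refl

  chain-∷ : ∀ i j d y → chain ℓ (suc i) (suc j) (d ∷ y) ≡ d ∷ chain ℓ i j y
  chain-∷ i j d y rewrite chain≡foldr (suc i) (suc j) (d ∷ y) | chain≡foldr i j y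
    | range≡iota (suc (suc i)) j | range≡iota (suc i) (j ∸ 1) | sym (∸-+-assoc j 1 i)
    | sym (map-suc-iota (suc i) ((j ∸ 1) ∸ i)) = foldr-applyR-∷ d y (iota (suc i) ((j ∸ 1) ∸ i)) (iota-positive i _)

  chain-front : ∀ j a y → chain ℓ 0 (suc (suc j)) (a ∷ y) ≡ swapAt ℓ 0 (a ∷ chain ℓ 0 (suc j) y)
  chain-front j a y = begin
      chain ℓ 0 (suc (suc j)) (a ∷ y)
    ≡⟨ chain≡foldr 0 (suc (suc j)) (a ∷ y) ⟩
      foldr (applyR ℓ) (a ∷ y) (range 1 (suc j))
    ≡⟨ cong (foldr (applyR ℓ) (a ∷ y)) (trans (range≡iota 1 (suc j)) (cong (1 ∷_) (sym (map-suc-iota 1 j)))) ⟩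
      swapAt ℓ 0 (foldr (applyR ℓ) (a ∷ y) (map suc (iota 1 j)))
    ≡⟨ cong (swapAt ℓ 0) (foldr-applyR-∷ a y (iota 1 j) (iota-positive 0 j)) ⟩
      swapAt ℓ 0 (a ∷ foldr (applyR ℓ) y (iota 1 j))
    ≡⟨ cong (λ z → swapAt ℓ 0 (a ∷ z)) (sym (trans (chain≡foldr 0 (suc j) y) (cong (foldr _ y) (range≡iota 1 j)))) ⟩
      swapAt ℓ 0 (a ∷ chain ℓ 0 (suc j) y)
    ∎
    where open ≡-Reasoning

  length-swapAt : ∀ k x → length (swapAt ℓ k x) ≡ length x
  length-swapAt zero [] = refl
  length-swapAt zero (_ ∷ []) = refl
  length-swapAt zero (d₁ ∷ d₂ ∷ r) with Rpair ℓ d₁ d₂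
  ... | _ = refl
  length-swapAt (suc k) [] = refl
  length-swapAt (suc k) (d ∷ r) = cong suc (length-swapAt k r)

  length-chain : ∀ i j y → length (chain ℓ i j y) ≡ length y
  length-chain i j y = trans (cong length (chain≡foldr i j y)) (go (range (suc i) (j ∸ 1)))
    where
    go : ∀ L → length (foldr (applyR ℓ) y L) ≡ length y
    go [] = refl
    go (m ∷ L) = trans (length-swapAt (m ∸ 1) _) (go L)

  nth-swapAt-front : ∀ a b r → nth 1 (swapAt ℓ 0 (a ∷ b ∷ r)) ≡ Rfirst a b
  nth-swapAt-front a b r with Rpair ℓ a b
  ... | _ = refl

  toFront≡chain : ∀ y → map (λ j → nth 1 (chain ℓ 0 j y)) (iota 1 (length y)) ≡ toFront y
  toFront≡chain [] = refl
  toFront≡chain (a ∷ y) = cong (a ∷_) (begin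
      map (λ j → nth 1 (chain ℓ 0 j (a ∷ y))) (iota 2 (length y))
    ≡⟨ cong (map _) (sym (map-suc-iota 1 (length y))) ⟩
      map (λ j → nth 1 (chain ℓ 0 j (a ∷ y))) (map suc (iota 1 (length y)))
    ≡⟨ sym (List.map-∘ (iota 1 (length y))) ⟩
      map (λ j → nth 1 (chain ℓ 0 (suc j) (a ∷ y))) (iota 1 (length y))
    ≡⟨ List.map-cong-local (All.tabulate carried) ⟩
      map (λ j → Rfirst a (nth 1 (chain ℓ 0 j y))) (iota 1 (length y))
    ≡⟨ List.map-∘ (iota 1 (length y)) ⟩
      map (Rfirst a) (map (λ j → nth 1 (chain ℓ 0 j y)) (iota 1 (length y)))
    ≡⟨ cong (map (Rfirst a)) (toFront≡chain y) ⟩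
      map (Rfirst a) (toFront y)
    ∎)
    where
    open ≡-Reasoning
    carried : ∀ {j} → j ∈ iota 1 (length y) →
      nth 1 (chain ℓ 0 (suc j) (a ∷ y)) ≡ Rfirst a (nth 1 (chain ℓ 0 j y))
    carried j∈ with ∈-iota⁻ 1 (length y) j∈
    carried {suc j} j∈ | _ , j<y rewrite chain-front j a y with chain ℓ 0 (suc j) y in chain≡
    ... | [] = contradiction (trans (sym (length-chain 0 (suc j) y)) (cong length chain≡))
                             (>⇒≢ (≤-trans (s≤s z≤n) (≤-pred j<y)))
    ... | b ∷ r = nth-swapAt-front a b r

  energyTerm : List Column → ℕ → ℕ → ℕ
  energyTerm x i j = H ℓ (nth i x) (nth (suc i) (chain ℓ i j x))

  energyRow : List Column → ℕ → ℕ → List ℕ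
  energyRow x n i = map (energyTerm x i) (range (suc i) n)

  D≡rows : ∀ x → D ℓ x ≡ sum (concatMap (energyRow x (length x)) (iota 1 (length x)))
  D≡rows x = cong (sum ∘ concatMap (energyRow x (length x))) (range≡iota 1 (length x))

  energyRow-front : ∀ d y → energyRow (d ∷ y) (suc (length y)) 1 ≡ map (H ℓ d) (toFront y)
  energyRow-front d y = begin
      map (λ j → H ℓ d (nth 2 (chain ℓ 1 j (d ∷ y)))) (range 2 (suc (length y)))
    ≡⟨ cong (map _) (trans (range≡iota 2 (suc (length y))) (sym (map-suc-iota 1 (length y)))) ⟩
      map (λ j → H ℓ d (nth 2 (chain ℓ 1 j (d ∷ y)))) (map suc (iota 1 (length y)))
    ≡⟨ sym (List.map-∘ (iota 1 (length y))) ⟩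
      map (λ j → H ℓ d (nth 2 (chain ℓ 1 (suc j) (d ∷ y)))) (iota 1 (length y))
    ≡⟨ List.map-cong (λ j → cong (H ℓ d ∘ nth 2) (chain-∷ 0 j d y)) (iota 1 (length y)) ⟩
      map (λ j → H ℓ d (nth 1 (chain ℓ 0 j y))) (iota 1 (length y))
    ≡⟨ List.map-∘ (iota 1 (length y)) ⟩
      map (H ℓ d) (map (λ j → nth 1 (chain ℓ 0 j y)) (iota 1 (length y)))
    ≡⟨ cong (map (H ℓ d)) (toFront≡chain y) ⟩
      map (H ℓ d) (toFront y)
    ∎
    where open ≡-Reasoning

  energyRow-∷ : ∀ d y i → 1 ≤ i → energyRow (d ∷ y) (suc (length y)) (suc i) ≡ energyRow y (length y) i
  energyRow-∷ d y i@(suc _) _ = begin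
      map (energyTerm (d ∷ y) (suc i)) (range (suc (suc i)) (suc m))
    ≡⟨ cong (map _) (trans (range≡iota (suc (suc i)) (suc m)) (sym (map-suc-iota (suc i) (m ∸ i)))) ⟩
      map (energyTerm (d ∷ y) (suc i)) (map suc (iota (suc i) (m ∸ i)))
    ≡⟨ sym (List.map-∘ (iota (suc i) (m ∸ i))) ⟩
      map (energyTerm (d ∷ y) (suc i) ∘ suc) (iota (suc i) (m ∸ i))
    ≡⟨ List.map-cong (λ j → cong (H ℓ (nth i y) ∘ nth (suc (suc i))) (chain-∷ i j d y)) (iota (suc i) (m ∸ i)) ⟩
      map (energyTerm y i) (iota (suc i) (m ∸ i))
    ≡⟨ cong (map (energyTerm y i)) (sym (range≡iota (suc i) m)) ⟩
      map (energyTerm y i) (range (suc i) m)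
    ∎
    where
    open ≡-Reasoning
    m = length y

  D-∷ : ∀ d y → D ℓ (d ∷ y) ≡ sum (map (H ℓ d) (toFront y)) + D ℓ y
  D-∷ d y = begin
      D ℓ (d ∷ y)
    ≡⟨ D≡rows (d ∷ y) ⟩
      sum (row 1 ++ concatMap row (iota 2 m))
    ≡⟨ sum-++ (row 1) (concatMap row (iota 2 m)) ⟩
      sum (row 1) + sum (concatMap row (iota 2 m))
    ≡⟨ cong₂ (λ a b → sum a + sum b) (energyRow-front d y) later-rows ⟩
      sum (map (H ℓ d) (toFront y)) + sum (concatMap (energyRow y m) (iota 1 m))
    ≡⟨ cong (sum (map (H ℓ d) (toFront y)) +_) (sym (D≡rows y)) ⟩
      sum (map (H ℓ d) (toFront y)) + D ℓ y
    ∎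
    where
    open ≡-Reasoning
    m = length y
    row = energyRow (d ∷ y) (suc m)
    later-rows : concatMap row (iota 2 m) ≡ concatMap (energyRow y m) (iota 1 m)
    later-rows = begin
        concatMap row (iota 2 m)
      ≡⟨ cong (concatMap row) (sym (map-suc-iota 1 m)) ⟩
        concatMap row (map suc (iota 1 m))
      ≡⟨ List.concatMap-map row suc (iota 1 m) ⟩
        concatMap (row ∘ suc) (iota 1 m)
      ≡⟨ cong concat (List.map-cong-local (All.tabulate (energyRow-∷ d y _ ∘ proj₁ ∘ ∈-iota⁻ 1 m))) ⟩
        concatMap (energyRow y m) (iota 1 m)
      ∎

  toFront-Col : ∀ {y} → All Col y → All Col (toFront y)
  toFront-Col [] = []
  toFront-Col {a ∷ y} (col-a ∷ _) =
    col-a ∷ All.map⁺ (All.tabulate {xs = toFront y} λ {e} _ → Rpair-column e col-a)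

  deleteFull-∷ : ∀ {d x} → full ∈ d ∷ x →
    d ≡ full × deleteFull ℓ (d ∷ x) ≡ x ⊎ full ∈ x × deleteFull ℓ (d ∷ x) ≡ d ∷ deleteFull ℓ x
  deleteFull-∷ {d} full∈ with listEq d (fullColumn ℓ) in d≟full
  ... | true = inj₁ (listEq-sound d full d≟full , refl)
  deleteFull-∷ {d} (here refl) | false = contradiction (trans (sym d≟full) (listEq-refl d)) λ ()
  deleteFull-∷ (there full∈) | false = inj₂ (full∈ , refl)

  toFront-deleteFull : ∀ {x} → All Col x → full ∈ x →
    ∃ λ A → ∃ λ B → toFront x ≡ A ++ full ∷ B × toFront (deleteFull ℓ x) ≡ A ++ B
  toFront-deleteFull {d ∷ x} (col-d ∷ cols) full∈ with deleteFull-∷ full∈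
  ... | inj₁ (refl , del≡) rewrite del≡ =
    [] , toFront x , cong (full ∷_) (List.map-id-local (All.map (cong proj₁ ∘ Rpair-full-left) (toFront-Col cols)))
       , refl
  ... | inj₂ (full∈x , del≡) rewrite del≡ with toFront-deleteFull cols full∈x
  ...   | A , B , front≡ , front×≡ = d ∷ map (Rfirst d) A , map (Rfirst d) B ,
    cong (d ∷_) (trans (cong (map (Rfirst d)) front≡)
                       (map-++-∷-fixed (Rfirst d) A B (cong proj₁ (Rpair-full-right col-d)))) ,
    cong (d ∷_) (trans (cong (map (Rfirst d)) front×≡) (List.map-++ (Rfirst d) A B))

  D-deleteFull : ∀ x → All Col x → full ∈ x → D ℓ x ≡ D ℓ (deleteFull ℓ x)
  D-deleteFull (d ∷ x) (col-d ∷ cols) full∈ with deleteFull-∷ full∈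
  ... | inj₁ (refl , del≡) rewrite del≡ =
    trans (D-∷ full x) (cong (_+ D ℓ x) (sum-map-zero (All.map H-full-left (toFront-Col cols))))
  ... | inj₂ (full∈x , del≡) rewrite del≡ with toFront-deleteFull cols full∈x
  ...   | A , B , front≡ , front×≡ = begin
      D ℓ (d ∷ x)
    ≡⟨ D-∷ d x ⟩
      sum (map (H ℓ d) (toFront x)) + D ℓ x
    ≡⟨ cong₂ _+_ same-sum (D-deleteFull x cols full∈x) ⟩
      sum (map (H ℓ d) (toFront (deleteFull ℓ x))) + D ℓ (deleteFull ℓ x)
    ≡⟨ sym (D-∷ d (deleteFull ℓ x)) ⟩
      D ℓ (d ∷ deleteFull ℓ x)
    ∎
    where
    open ≡-Reasoning
    same-sum : sum (map (H ℓ d) (toFront x)) ≡ sum (map (H ℓ d) (toFront (deleteFull ℓ x)))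
    same-sum rewrite front≡ | front×≡ = sum-map-remove-zero (H ℓ d) A B (H-full-right col-d)

lemma2p48 : (ℓ n s : ℕ) → 2 ≤ ℓ → 1 ≤ n → (x : List Column) →
    InFdot ℓ n s x → Yamanouchi (word x) → fullColumn ℓ ∈ x →
    D ℓ x ≡ D ℓ (deleteFull ℓ x)
lemma2p48 ℓ n s _ _ x (_ , columns , _) _ full∈ = D-deleteFull ℓ x columns full∈
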